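{- For every $(\sigma,\tau_0,\tau_1)\in S_3^3$, the TRIP maps $(\sigma,\tau_0,\tau_1)$ and $(\sigma(13),(12)\tau_1,(12)\tau_0)$ give the same partition of $\triangle$: for every $n\ge1$ the collection of triangles $\{\triangle_{(\sigma,\tau_0,\tau_1)}(i_1,\ldots,i_n)\}$ coincides with $\{\triangle_{(\sigma(13),(12)\tau_1,(12)\tau_0)}(i_1,\ldots,i_n)\}$, where the $i_j$ range over $\{0,1\}$.
   Context: Let $\triangle=\{(x,y):1>x>y>0\}$; $\pi(x,y,z)=(y/x,z/x)$, and for a $3\times3$ matrix $M$, $\pi(M)$ is the triangle whose vertices are the $\pi$-images of the columns of $M$. $V=\begin{pmatrix}1&1&1\\0&1&1\\0&0&1\end{pmatrix}$, $F_0=\begin{pmatrix}0&0&1\\1&0&0\\0&1&1\end{pmatrix}$, $F_1=\begin{pmatrix}1&0&1\\0&1&0\\0&0&1\end{pmatrix}$. Elements of $S_3$ are identified with permutation matrices: $e=I$, $(12)=\begin{pmatrix}0&1&0\\1&0&0\\0&0&1\end{pmatrix}$, $(13)=\begin{pmatrix}0&0&1\\0&1&0\\1&0&0\end{pmatrix}$, $(23)=\begin{pmatrix}1&0&0\\0&0&1\\0&1&0\end{pmatrix}$, $(123)=\begin{pmatrix}0&1&0\\0&0&1\\1&0&0\end{pmatrix}$, $(132)=\begin{pmatrix}0&0&1\\1&0&0\\0&1&0\end{pmatrix}$, and products of permutations are matrix products. For $(\sigma,\tau_0,\tau_1)\in S_3^3$, $F_i(\sigma,\tau_0,\tau_1)=\sigma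 F_i\tau_i$ and $\triangle_{(\sigma,\tau_0,\tau_1)}(i_1,\ldots,i_n)=\pi(VF_{i_1}(\sigma,\tau_0,\tau_1)\cdots F_{i_n}(\sigma,\tau_0,\tau_1))$. -}

module Defs where

open import Data.Nat using (ℕ; zero; suc; _+_; _*_)
open import Data.Integer using (ℤ; +_)
open import Data.Rational using (ℚ; _/_)
open import Data.Fin using (Fin; zero; suc)
open import Data.Vec using (Vec; []; _∷_; foldr)
open import Data.Maybe using (Maybe; just; nothing)
open import Data.Product using (_×_; _,_; Σ)
open import Relation.Binary.PropositionalEquality using (_≡_)

-- 3×3 matrices with natural-number entries (all matrices involved are nonnegative)
Mat : Set
Mat = Fin 3 → Fin 3 → ℕ

sum3 : (Fin 3 → ℕ) → ℕ
sum3 f = f zero + f (suc zero) + f (suc (suc zero))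

_⊗_ : Mat → Mat → Mat
(A ⊗ B) i j = sum3 (λ k → A i k * B k j)
infixl 7 _⊗_

I₃ : Mat
I₃ zero zero = 1
I₃ (suc zero) (suc zero) = 1
I₃ (suc (suc zero)) (suc (suc zero)) = 1
I₃ _ _ = 0

mk : ℕ → ℕ → ℕ → ℕ → ℕ → ℕ → ℕ → ℕ → ℕ → Mat
mk a b c d e f g h i zero zero = a
mk a b c d e f g h i zero (suc zero) = b
mk a b c d e f g h i zero (suc (suc zero)) = c
mk a b c d e f g h i (suc zero) zero = d
mk a b c d e f g h i (suc zero) (suc zero) = e
mk a b c d e f g h i (suc zero) (suc (suc zero)) = f
mk a b c d e f g h i (suc (suc zero)) zero = g
mk a b c d e f g h i (suc (suc zero)) (suc zero) = h
mk a b c d e f g h i (suc (suc zero)) (suc (suc zero)) = i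

V F₀ F₁ : Mat
V  = mk 1 1 1  0 1 1  0 0 1
F₀ = mk 0 0 1  1 0 0  0 1 1
F₁ = mk 1 0 1  0 1 0  0 0 1

F : Fin 2 → Mat
F zero = F₀
F (suc zero) = F₁

data S₃ : Set where
  e p12 p13 p23 p123 p132 : S₃

pm : S₃ → Mat
pm e    = I₃
pm p12  = mk 0 1 0  1 0 0  0 0 1
pm p13  = mk 0 0 1  0 1 0  1 0 0
pm p23  = mk 1 0 0  0 0 1  0 1 0
pm p123 = mk 0 1 0  0 0 1  1 0 0
pm p132 = mk 0 0 1  1 0 0  0 1 0

Triple : Set
Triple = Mat × Mat × Mat

Fσ : Triple → Fin 2 → Mat
Fσ (σ , τ₀ , τ₁) zero = σ ⊗ F₀ ⊗ τ₀
Fσ (σ , τ₀ , τ₁) (suc zero) = σ ⊗ F₁ ⊗ τ₁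

trip : S₃ → S₃ → S₃ → Triple
trip σ τ₀ τ₁ = pm σ , pm τ₀ , pm τ₁

tripDual : S₃ → S₃ → S₃ → Triple
tripDual σ τ₀ τ₁ = pm σ ⊗ pm p13 , pm p12 ⊗ pm τ₁ , pm p12 ⊗ pm τ₀

wordMat : Triple → {n : ℕ} → Vec (Fin 2) n → Mat
wordMat t = foldr _ (λ i M → Fσ t i ⊗ M) I₃

Point : Set
Point = Maybe (ℚ × ℚ)

π : ℕ → ℕ → ℕ → Point
π zero y z = nothing
π (suc x) y z = just ((+ y) / suc x , (+ z) / suc x)

Triangle : Set
Triangle = Fin 3 → Point

πM : Mat → Triangle
πM M j = π (M zero j) (M (suc zero) j) (M (suc (suc zero)) j)

tri : Triple → {n : ℕ} → Vec (Fin 2) n → Triangle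
tri t w = πM (V ⊗ wordMat t w)

_≈T_ : Triangle → Triangle → Set
T ≈T T' = (∀ i → Σ (Fin 3) λ j → T i ≡ T' j) × (∀ j → Σ (Fin 3) λ i → T' j ≡ T i)

SamePartition : ℕ → Triple → Triple → Set
SamePartition n t t' =
  (∀ (w : Vec (Fin 2) n) → Σ (Vec (Fin 2) n) λ w' → tri t w ≈T tri t' w')
  × (∀ (w' : Vec (Fin 2) n) → Σ (Vec (Fin 2) n) λ w → tri t w ≈T tri t' w')

-- Conjugation by the permutations (13) and (12) swaps the two TRIP matrices:
-- (13) F₀ (12) = F₁ and (13) F₁ (12) = F₀. By associativity the i-th matrix of the
-- dual triple is therefore the (1-i)-th matrix of the original one, so the dual
-- triangle of a word w is the original triangle of its letterwise complement, and
-- complementing letters is a bijection of {0,1}ⁿ. Nothing here uses that σ, τ₀, τ₁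
-- are permutations, nor that n ≥ 1.
module Submission where

open import Defs
open import Data.Nat using (ℕ; _+_; _*_; _≟_; _≤_)
open import Data.Nat.Properties using (*-distribʳ-+; *-distribˡ-+; *-assoc)
open import Data.Nat.Tactic.RingSolver using (solve-∀)
open import Data.Fin using (Fin; zero; suc; opposite)
open import Data.Fin.Properties using (all?; opposite-involutive)
open import Data.Vec using (Vec; []; _∷_; map)
open import Data.Vec.Properties using (map-∘; map-cong; map-id)
open import Data.Product using (_,_)
open import Level using (0ℓ)
open import Relation.Binary using (Setoid; Decidable)
open import Relation.Nullary.Decidable using (from-yes; map′)
open import Relation.Binary.PropositionalEquality
  using (_≡_; refl; sym; trans; cong; cong₂; module ≡-Reasoning)

sum3-cong : ∀ {f g : Fin 3 → ℕ} → (∀ k → f k ≡ g k) → sum3 f ≡ sum3 g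
sum3-cong p = cong₂ _+_ (cong₂ _+_ (p zero) (p (suc zero))) (p (suc (suc zero)))

sum3-*-distribʳ : ∀ (f : Fin 3 → ℕ) c → sum3 f * c ≡ sum3 (λ k → f k * c)
sum3-*-distribʳ f c = begin
  (f₀ + f₁ + f₂) * c        ≡⟨ *-distribʳ-+ c (f₀ + f₁) f₂ ⟩
  (f₀ + f₁) * c + f₂ * c    ≡⟨ cong (_+ f₂ * c) (*-distribʳ-+ c f₀ f₁) ⟩
  f₀ * c + f₁ * c + f₂ * c  ∎
  where
  open ≡-Reasoning
  f₀ = f zero; f₁ = f (suc zero); f₂ = f (suc (suc zero))

sum3-*-distribˡ : ∀ c (f : Fin 3 → ℕ) → c * sum3 f ≡ sum3 (λ k → c * f k)
sum3-*-distribˡ c f = begin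
  c * (f₀ + f₁ + f₂)        ≡⟨ *-distribˡ-+ c (f₀ + f₁) f₂ ⟩
  c * (f₀ + f₁) + c * f₂    ≡⟨ cong (_+ c * f₂) (*-distribˡ-+ c f₀ f₁) ⟩
  c * f₀ + c * f₁ + c * f₂  ∎
  where
  open ≡-Reasoning
  f₀ = f zero; f₁ = f (suc zero); f₂ = f (suc (suc zero))

sum3-comm : ∀ (g : Fin 3 → Fin 3 → ℕ) →
  sum3 (λ k → sum3 (λ l → g k l)) ≡ sum3 (λ l → sum3 (λ k → g k l))
sum3-comm g = interchange (g zero zero) (g zero (suc zero)) (g zero (suc (suc zero)))
  (g (suc zero) zero) (g (suc zero) (suc zero)) (g (suc zero) (suc (suc zero)))
  (g (suc (suc zero)) zero) (g (suc (suc zero)) (suc zero)) (g (suc (suc zero)) (suc (suc zero)))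
  where
  interchange : ∀ a b c d e f g h i →
    (a + b + c) + (d + e + f) + (g + h + i) ≡ (a + d + g) + (b + e + h) + (c + f + i)
  interchange = solve-∀

infix 4 _≐_
record _≐_ (A B : Mat) : Set where
  constructor entrywise
  field entry : ∀ i j → A i j ≡ B i j
open _≐_

≐-setoid : Setoid 0ℓ 0ℓ
≐-setoid = record
  { Carrier       = Mat
  ; _≈_           = _≐_
  ; isEquivalence = record
    { refl  = entrywise λ _ _ → refl
    ; sym   = λ p → entrywise λ i j → sym (entry p i j)
    ; trans = λ p q → entrywise λ i j → trans (entry p i j) (entry q i j)
    }
  }

open Setoid ≐-setoid using () renaming (refl to ≐-refl)

infix 4 _≐?_
_≐?_ : Decidable _≐_
A ≐? B = map′ entrywise entry (all? λ i → all? λ j → A i j ≟ B i j)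

⊗-cong : ∀ {A A′ B B′} → A ≐ A′ → B ≐ B′ → A ⊗ B ≐ A′ ⊗ B′
⊗-cong p q = entrywise λ i j → sum3-cong λ k → cong₂ _*_ (entry p i k) (entry q k j)

⊗-assoc : ∀ A B C → (A ⊗ B) ⊗ C ≐ A ⊗ (B ⊗ C)
⊗-assoc A B C = entrywise λ i j → begin
  sum3 (λ k → sum3 (λ l → A i l * B l k) * C k j)    ≡⟨ sum3-cong (λ k → sum3-*-distribʳ (λ l → A i l * B l k) (C k j)) ⟩
  sum3 (λ k → sum3 (λ l → A i l * B l k * C k j))    ≡⟨ sum3-cong (λ k → sum3-cong λ l → *-assoc (A i l) (B l k) (C k j)) ⟩
  sum3 (λ k → sum3 (λ l → A i l * (B l k * C k j)))  ≡⟨ sum3-comm (λ k l → A i l * (B l k * C k j)) ⟩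
  sum3 (λ l → sum3 (λ k → A i l * (B l k * C k j)))  ≡⟨ sum3-cong (λ l → sum3-*-distribˡ (A i l) (λ k → B l k * C k j)) ⟨
  sum3 (λ l → A i l * sum3 (λ k → B l k * C k j))    ∎
  where open ≡-Reasoning

⊗-sandwich : ∀ σ P A Q τ {B} → P ⊗ A ⊗ Q ≐ B → (σ ⊗ P) ⊗ A ⊗ (Q ⊗ τ) ≐ σ ⊗ B ⊗ τ
⊗-sandwich σ P A Q τ {B} PAQ≐B = begin
  (σ ⊗ P) ⊗ A ⊗ (Q ⊗ τ)    ≈⟨ ⊗-assoc ((σ ⊗ P) ⊗ A) Q τ ⟨
  (σ ⊗ P) ⊗ A ⊗ Q ⊗ τ      ≈⟨ ⊗-cong (⊗-cong (⊗-assoc σ P A) (≐-refl {Q})) (≐-refl {τ}) ⟩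
  σ ⊗ (P ⊗ A) ⊗ Q ⊗ τ      ≈⟨ ⊗-cong (⊗-assoc σ (P ⊗ A) Q) (≐-refl {τ}) ⟩
  σ ⊗ (P ⊗ A ⊗ Q) ⊗ τ      ≈⟨ ⊗-cong (⊗-cong (≐-refl {σ}) PAQ≐B) (≐-refl {τ}) ⟩
  σ ⊗ B ⊗ τ                ∎
  where open import Relation.Binary.Reasoning.Setoid ≐-setoid

F₀-conj : pm p13 ⊗ F₀ ⊗ pm p12 ≐ F₁
F₀-conj = from-yes (pm p13 ⊗ F₀ ⊗ pm p12 ≐? F₁)

F₁-conj : pm p13 ⊗ F₁ ⊗ pm p12 ≐ F₀
F₁-conj = from-yes (pm p13 ⊗ F₁ ⊗ pm p12 ≐? F₀)

dual : Triple → Triple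
dual (σ , τ₀ , τ₁) = σ ⊗ pm p13 , pm p12 ⊗ τ₁ , pm p12 ⊗ τ₀

Fσ-dual : ∀ t i → Fσ (dual t) i ≐ Fσ t (opposite i)
Fσ-dual (σ , τ₀ , τ₁) zero       = ⊗-sandwich σ (pm p13) F₀ (pm p12) τ₁ F₀-conj
Fσ-dual (σ , τ₀ , τ₁) (suc zero) = ⊗-sandwich σ (pm p13) F₁ (pm p12) τ₀ F₁-conj

wordMat-relabel : ∀ t t′ (f : Fin 2 → Fin 2) → (∀ i → Fσ t′ i ≐ Fσ t (f i)) →
  ∀ {n} (w : Vec (Fin 2) n) → wordMat t′ w ≐ wordMat t (map f w)
wordMat-relabel t t′ f p []      = ≐-refl
wordMat-relabel t t′ f p (i ∷ w) = ⊗-cong (p i) (wordMat-relabel t t′ f p w)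

πM-cong : ∀ {A B} → A ≐ B → ∀ k → πM A k ≡ πM B k
πM-cong (entrywise p) k rewrite p zero k | p (suc zero) k | p (suc (suc zero)) k = refl

tri-dual : ∀ t {n} (w : Vec (Fin 2) n) k → tri (dual t) w k ≡ tri t (map opposite w) k
tri-dual t w = πM-cong (⊗-cong (≐-refl {V}) (wordMat-relabel t (dual t) opposite (Fσ-dual t) w))

map-opposite-involutive : ∀ {n} (w : Vec (Fin 2) n) → map opposite (map opposite w) ≡ w
map-opposite-involutive w = begin
  map opposite (map opposite w)        ≡⟨ map-∘ opposite opposite w ⟨
  map (λ i → opposite (opposite i)) w  ≡⟨ map-cong opposite-involutive w ⟩
  map (λ i → i) w                      ≡⟨ map-id w ⟩
  w                                    ∎
  where open ≡-Reasoning

≈T-pointwise : ∀ {T T′ : Triangle} → (∀ k → T k ≡ T′ k) → T ≈T T′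
≈T-pointwise p = (λ k → k , p k) , (λ k → k , sym (p k))

samePartition-dual : ∀ n t → SamePartition n t (dual t)
samePartition-dual n t =
  (λ w → map opposite w , ≈T-pointwise λ k → begin
     tri t w k                                     ≡⟨ cong (λ v → tri t v k) (map-opposite-involutive w) ⟨
     tri t (map opposite (map opposite w)) k       ≡⟨ tri-dual t (map opposite w) k ⟨
     tri (dual t) (map opposite w) k               ∎) ,
  (λ w′ → map opposite w′ , ≈T-pointwise λ k → sym (tri-dual t w′ k))
  where open ≡-Reasoning

mainTheorem3 : (σ τ₀ τ₁ : S₃) (n : ℕ) → 1 ≤ n →
    SamePartition n (trip σ τ₀ τ₁) (tripDual σ τ₀ τ₁)
mainTheorem3 σ τ₀ τ₁ n _ = samePartition-dual n (trip σ τ₀ τ₁)
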